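{- For every permutation $\pi\in\tilde{\mathcal{D}}^2_{2n}$, the graph $\Gamma(\pi)$ is terrain-like, i.e. $\Gamma(\pi)\in\mathcal{T}_n$.
   Context: $[n]=\{1,\dots,n\}$; $\mathcal{S}_{2n}$ is the symmetric group on $[2n]$, with product meaning composition, $(\sigma\rho)(x)=\sigma(\rho(x))$; $(a,b)$ denotes a transposition. $\tilde{\mathcal{D}}^2_{2n}$ is the set of $\pi\in\mathcal{S}_{2n}$ with $\pi(2i-1)\ge 2i-1$ and $\pi(2i)<2i$ for all $i\in[n]$, and $\pi(2i-1)>2i-1$ for all $i\in[n-1]$. A graph $G=([n],E)$ is terrain-like if for all $a<b<c<d$, $\{a,c\},\{b,d\}\in E$ implies $\{a,d\}\in E$; $\mathcal{T}_n$ is the set of such graphs. On $\binom{[n]}{2}$ define $\preceq$ by: for $a<b$, $c<d$, $\{a,b\}\preceq\{c,d\}$ iff $c\le a<b\le d$; a valid order is a total order $\le$ on $\binom{[n]}{2}$ with $e\preceq e'\Rightarrow e\le e'$. For a permutation $\sigma$ and $2\le i<j\le 2n-1$ with $i$ even and $j$ odd, $i$ and $j$ are in edge configuration in $\sigma$ if ($\sigma^{ -1}(i)<\sigma^{ -1}(j)$ iff $\sigma^{ -1}(i)\equiv\sigma^{ -1}(j)\pmod 2$). The map $\Gamma$: start with $\sigma:=\pi$ and the edgeless graph on $[n]$; iterate over all pairs $\{u,v\}$, $u<v$, in increasing order w.r.t. a valid order $\le$; if $2u$ and $2v-1$ are in edge configuration in the current $\sigma$, insert edge $\{u,v\}$ and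 replace $\sigma$ by $(2u,2v-1)\sigma$; the final graph is $\Gamma(\pi)$ (independent of the valid order chosen). -}

module Defs where

open import Data.Nat using (ℕ; _≤_; _<_; _≥_; _∸_; _*_; _%_; _<ᵇ_; _≡ᵇ_)
open import Data.Bool using (Bool; if_then_else_; _∧_; _∨_; not)
open import Data.Fin as Fin using (Fin; toℕ; combine)
open import Data.Fin.Permutation using (Permutation′; _⟨$⟩ʳ_; _⟨$⟩ˡ_; _∘ₚ_; transpose)
open import Data.Product using (_×_; _,_; proj₁; proj₂)
open import Data.List using (List; []; _∷_; length; lookup; foldl)
open import Data.List.Membership.Propositional using (_∈_)
open import Data.List.Relation.Unary.All using (All)
open import Data.List.Relation.Unary.Unique.Propositional using (Unique)
open import Relation.Binary.PropositionalEquality using (_≡_; _≢_)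
open import Relation.Nullary using (¬_)

-- Conventions: [n] is represented by Fin n (vertex u ∈ [n] ↔ Fin index u-1),
-- [2n] by Fin (n * 2) (element x ∈ [2n] ↔ Fin index x-1).
-- Hence 1-indexed 2u ↔ index 2(u-1)+1 = combine u 1, and
-- 1-indexed 2v-1 ↔ index 2(v-1) = combine v 0.

evenPt : {n : ℕ} → Fin n → Fin (n * 2)
evenPt u = combine u (Fin.suc Fin.zero)

oddPt : {n : ℕ} → Fin n → Fin (n * 2)
oddPt v = combine v Fin.zero

-- The set D̃²_{2n}, transcribed with 0-indexed positions:
-- 1-indexed 2i-1 is 0-indexed k = 2i-2 (even k); 1-indexed 2i is k = 2i-1 (odd k).
-- π(2i-1) ≥ 2i-1, π(2i) < 2i for all i ∈ [n]; π(2i-1) > 2i-1 for i ∈ [n-1].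
record InDTilde (n : ℕ) (π : Permutation′ (n * 2)) : Set where
  field
    oddPos≥  : (i : Fin n) → toℕ (π ⟨$⟩ʳ oddPt i) ≥ toℕ (oddPt i)
    evenPos< : (i : Fin n) → toℕ (π ⟨$⟩ʳ evenPt i) < toℕ (evenPt i)
    oddPos>  : (i : Fin n) → toℕ i < n ∸ 1 → toℕ (oddPt i) < toℕ (π ⟨$⟩ʳ oddPt i)

-- Graphs on [n]: a list of edges, each edge {u,v} with u < v stored as (u , v).
Graph : ℕ → Set
Graph n = List (Fin n × Fin n)

TerrainLike : {n : ℕ} → Graph n → Set
TerrainLike {n} E = (a b c d : Fin n) → a Fin.< b → b Fin.< c → c Fin.< d →
  (a , c) ∈ E → (b , d) ∈ E → (a , d) ∈ E

_⪯_ : {n : ℕ} → (Fin n × Fin n) → (Fin n × Fin n) → Set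
(a , b) ⪯ (c , d) = (c Fin.≤ a) × (b Fin.≤ d)

-- A valid order on binom([n],2), represented as the list of all pairs in
-- increasing order: every pair {u<v} occurs exactly once, and e ⪯ e'
-- implies e is listed no later than e'.
record ValidOrder (n : ℕ) (L : List (Fin n × Fin n)) : Set where
  field
    increasing : All (λ e → proj₁ e Fin.< proj₂ e) L
    unique     : Unique L
    complete   : (u v : Fin n) → u Fin.< v → (u , v) ∈ L
    monotone   : (i j : Fin (length L)) → lookup L i ⪯ lookup L j → toℕ i ≤ toℕ j

-- i and j are in edge configuration in σ:
-- σ⁻¹(i) < σ⁻¹(j)  iff  σ⁻¹(i) ≡ σ⁻¹(j) (mod 2).
-- (Positions shifted by 1 preserve both order and parity comparison.)
edgeConfig : {m : ℕ} → Permutation′ m → Fin m → Fin m → Bool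
edgeConfig σ i j =
  let p = toℕ (σ ⟨$⟩ˡ i) ; q = toℕ (σ ⟨$⟩ˡ j)
      lt = p <ᵇ q ; par = (p % 2) ≡ᵇ (q % 2)
  in (lt ∧ par) ∨ (not lt ∧ not par)

-- One step of Γ on pair (u,v): if 2u and 2v-1 are in edge configuration,
-- add edge {u,v} and replace σ by (2u,2v-1)σ  (i.e. x ↦ τ(σ(x));
-- note stdlib's  σ ∘ₚ τ  means "first σ, then τ").
ΓStep : {n : ℕ} → Permutation′ (n * 2) × Graph n → Fin n × Fin n →
        Permutation′ (n * 2) × Graph n
ΓStep (σ , E) (u , v) =
  if edgeConfig σ (evenPt u) (oddPt v)
  then (σ ∘ₚ transpose (evenPt u) (oddPt v) , (u , v) ∷ E)
  else (σ , E)

Γ : {n : ℕ} → List (Fin n × Fin n) → Permutation′ (n * 2) → Graph n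
Γ L π = proj₂ (foldl ΓStep (π , []) L)

-- Rank the 0-indexed positions by listing the odd ones first and then the even ones, each
-- group in increasing order. When the pair {u,v} is processed, the positions p of 2u and of
-- 2v-1 are separated by 2v-2: p ≤ 2v-2 if p is even and p > 2v-2 if p is odd (initially this
-- follows from the definition of D̃²₂ₙ, and it is maintained because a valid order processes
-- each row from left to right).
-- For two such positions, being in edge configuration means exactly that 2u is ranked below
-- 2v-1, so every step of Γ is a compare-exchange: afterwards 2u carries the larger and 2v-1
-- the smaller of their two ranks, and an edge is inserted iff they were swapped. Hence the
-- rank of each 2u only grows and that of each 2v-1 only shrinks.
-- Given edges {a,c} and {b,d} with a < b < c < d, look at the time {a,d} is processed. The
-- rank of 2a is then at most that of 2j-1 when the last edge {a,j} was inserted, where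
-- c ≤ j < d; the rank of 2d-1 is at least that of 2i when the last edge {i,d} was inserted,
-- where a < i ≤ b. The pair {i,j} was processed before both, and left 2j-1 ranked below 2i;
-- by monotonicity 2a is ranked below 2d-1, so {a,d} becomes an edge.
module Submission where

open import Defs
open import Data.Nat
open import Data.Nat.Properties
open import Data.Nat.DivMod using (m%n<n; m*n%n≡0; [m+kn]%n≡m%n)
open import Data.Bool using (Bool; true; false; _∧_; _∨_; not)
open import Data.Fin as Fin using (Fin; toℕ; fromℕ<; combine)
open import Data.Fin.Properties
  using (toℕ-combine; combine-injectiveˡ; combine-remQuot; toℕ-fromℕ<; toℕ-injective; toℕ<n)
open import Data.Fin.Permutation using (Permutation′; _⟨$⟩ʳ_; _⟨$⟩ˡ_; _∘ₚ_; transpose; inverseʳ)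
import Data.Fin.Permutation.Components as PC
open import Data.List using (List; []; _∷_; length; lookup; foldl; take)
open import Data.List.Properties using (take-suc; take-all; foldl-∷ʳ)
open import Data.List.Membership.Propositional using (_∈_)
open import Data.List.Membership.Propositional.Properties using (∈-lookup)
open import Data.List.Relation.Unary.Any using (here; there; index)
open import Data.List.Relation.Unary.Any.Properties using (lookup-index)
import Data.List.Relation.Unary.All as All
open import Data.List.Relation.Binary.Subset.Propositional using (_⊆_)
open import Data.List.Relation.Binary.Subset.Propositional.Properties using (⊆-refl; ⊆-trans; xs⊆x∷xs)
open import Data.Product using (_×_; _,_; proj₁; proj₂; ∃-syntax; uncurry)
open import Data.Sum using (_⊎_; inj₁; inj₂)
open import Function using (_∘_; flip)
open import Relation.Nullary using (¬_; yes; no; contradiction)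
open import Relation.Nullary.Reflects using (ofʸ; ofⁿ)
open import Relation.Nullary.Decidable using (dec-true; dec-false)
open import Relation.Binary.Definitions using (Reflexive; Transitive)
open import Relation.Binary.PropositionalEquality

inEdgeConfig : ℕ → ℕ → Bool
inEdgeConfig p q = ((p <ᵇ q) ∧ ((p % 2) ≡ᵇ (q % 2))) ∨ (not (p <ᵇ q) ∧ not ((p % 2) ≡ᵇ (q % 2)))

2*n%2≡0 : ∀ n → (2 * n) % 2 ≡ 0
2*n%2≡0 n = trans (cong (_% 2) (*-comm 2 n)) (m*n%n≡0 n 2)

1+2*n%2≡1 : ∀ n → suc (2 * n) % 2 ≡ 1
1+2*n%2≡1 n = trans (cong (λ x → suc x % 2) (*-comm 2 n)) ([m+kn]%n≡m%n 1 n 2)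

1+2*n<odd⇒2*[1+n]< : ∀ {n p} → suc (2 * n) < p → p % 2 ≡ 1 → 2 * suc n < p
1+2*n<odd⇒2*[1+n]< {n} {p} 1+2n<p p-odd = ≤∧≢⇒< (subst (_≤ p) (sym (*-suc 2 n)) 1+2n<p) λ 2[1+n]≡p →
  contradiction (trans (sym (2*n%2≡0 (suc n))) (trans (cong (_% 2) 2[1+n]≡p) p-odd)) 0≢1+n

Separated : ℕ → ℕ → Set
Separated y p = (p % 2 ≡ 0 → p ≤ y) × (p % 2 ≡ 1 → y < p)

even-separated : ∀ {y p} → p % 2 ≡ 0 → p ≤ y → Separated y p
even-separated p-even p≤y = (λ _ → p≤y) , λ p-odd → contradiction (trans (sym p-even) p-odd) 0≢1+n

odd-separated : ∀ {y p} → p % 2 ≡ 1 → y < p → Separated y p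
odd-separated p-odd y<p = (λ p-even → contradiction (trans (sym p-even) p-odd) 0≢1+n) , λ _ → y<p

separated-raise : ∀ {n p} → Separated (suc (2 * n)) p → Separated (2 * suc n) p
separated-raise {n} (p-even , p-odd) =
  (λ e → ≤-trans (p-even e) (≤-trans (n≤1+n _) (≤-reflexive (sym (*-suc 2 n))))) ,
  λ o → 1+2*n<odd⇒2*[1+n]< (p-odd o) o

rankWithParity : ℕ → ℕ → ℕ → ℕ
rankWithParity N zero    p = N + p
rankWithParity N (suc _) p = p

rank : ℕ → ℕ → ℕ
rank N p = rankWithParity N (p % 2) p

RankOrdered : ℕ → ℕ → ℕ → Bool → Set
RankOrdered N p q true  = rank N p < rank N q
RankOrdered N p q false = rank N q < rank N p

rankOrdered : ∀ {N y p q} → p < N → q < N → p ≢ q → Separated y p → Separated y q →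
              RankOrdered N p q (inEdgeConfig p q)
rankOrdered {N} {p = p} {q} p<N q<N p≢q (p-even , p-odd) (q-even , q-odd)
  with p % 2 in pe | m%n<n p 2 | q % 2 in qe | m%n<n q 2 | p <ᵇ q | <ᵇ-reflects-< p q
... | 0 | _ | 0 | _ | true  | ofʸ p<q rewrite pe | qe = +-monoʳ-< N p<q
... | 0 | _ | 0 | _ | false | ofⁿ p≮q rewrite pe | qe = +-monoʳ-< N (≤∧≢⇒< (≮⇒≥ p≮q) (p≢q ∘ sym))
... | 0 | _ | 1 | _ | true  | ofʸ _   rewrite pe | qe = <-≤-trans q<N (m≤m+n N p)
... | 0 | _ | 1 | _ | false | ofⁿ p≮q = contradiction (≤-<-trans (p-even refl) (q-odd refl)) p≮q
... | 1 | _ | 0 | _ | true  | ofʸ p<q = contradiction (≤-<-trans (q-even refl) (p-odd refl)) (<⇒≯ p<q)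
... | 1 | _ | 0 | _ | false | ofⁿ _   rewrite pe | qe = <-≤-trans p<N (m≤m+n N q)
... | 1 | _ | 1 | _ | true  | ofʸ p<q rewrite pe | qe = p<q
... | 1 | _ | 1 | _ | false | ofⁿ p≮q rewrite pe | qe = ≤∧≢⇒< (≮⇒≥ p≮q) (p≢q ∘ sym)
... | suc (suc _) | s≤s (s≤s ()) | _ | _ | _ | _
... | _ | _ | suc (suc _) | s≤s (s≤s ()) | _ | _

separated-winner : ∀ {N n p q} → q < N → Separated (2 * n) p → Separated (2 * n) q →
                   rank N p < rank N q → Separated (2 * suc n) q
separated-winner {N} {n} {p} {q} q<N (_ , p-odd) (q-even , q-odd) rp<rq
  with q % 2 in qe | m%n<n q 2
... | 0 | _ = (λ _ → ≤-trans (q-even refl) (*-monoʳ-≤ 2 (n≤1+n n))) , λ ()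
... | 1 | _ with p % 2 | m%n<n p 2
...   | 0 | _ = contradiction (≤-<-trans (m≤m+n N p) rp<rq) (<⇒≯ q<N)
...   | 1 | _ = (λ ()) , λ _ → 1+2*n<odd⇒2*[1+n]< (<-≤-trans (s≤s (p-odd refl)) rp<rq) qe
...   | suc (suc _) | s≤s (s≤s ())
separated-winner _ _ _ _ | suc (suc _) | s≤s (s≤s ())

fin-between : ∀ {n x} {v : Fin n} → suc x < toℕ v → ∃[ w ] x < toℕ w × w Fin.< v
fin-between {x = x} {v} 1+x<v =
  fromℕ< (<-trans 1+x<v (toℕ<n v)) ,
  subst (x <_) (sym (toℕ-fromℕ< _)) (n<1+n x) ,
  subst (_< toℕ v) (sym (toℕ-fromℕ< _)) 1+x<v

toℕ-oddPt : ∀ {n} (v : Fin n) → toℕ (oddPt v) ≡ 2 * toℕ v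
toℕ-oddPt v = trans (toℕ-combine v Fin.zero) (+-identityʳ _)

toℕ-evenPt : ∀ {n} (u : Fin n) → toℕ (evenPt u) ≡ suc (2 * toℕ u)
toℕ-evenPt u = trans (toℕ-combine u (Fin.suc Fin.zero)) (+-comm _ 1)

toℕ-oddPt-%2 : ∀ {n} (v : Fin n) → toℕ (oddPt v) % 2 ≡ 0
toℕ-oddPt-%2 v = trans (cong (_% 2) (toℕ-oddPt v)) (2*n%2≡0 (toℕ v))

toℕ-evenPt-%2 : ∀ {n} (u : Fin n) → toℕ (evenPt u) % 2 ≡ 1
toℕ-evenPt-%2 u = trans (cong (_% 2) (toℕ-evenPt u)) (1+2*n%2≡1 (toℕ u))

evenPt≢oddPt : ∀ {n} (u v : Fin n) → evenPt u ≢ oddPt v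
evenPt≢oddPt u v eq =
  contradiction (trans (sym (toℕ-oddPt-%2 v)) (trans (cong (λ x → toℕ x % 2) (sym eq)) (toℕ-evenPt-%2 u))) 0≢1+n

evenPt-injective : ∀ {n} {u u′ : Fin n} → evenPt u ≡ evenPt u′ → u ≡ u′
evenPt-injective {u = u} {u′} = combine-injectiveˡ u _ u′ _

oddPt-injective : ∀ {n} {v v′ : Fin n} → oddPt v ≡ oddPt v′ → v ≡ v′
oddPt-injective {v = v} {v′} = combine-injectiveˡ v _ v′ _

oddPt-or-evenPt : ∀ {n} (x : Fin (n * 2)) → (∃[ i ] x ≡ oddPt i) ⊎ (∃[ i ] x ≡ evenPt i)
oddPt-or-evenPt {n} x = classify (Fin.remQuot {n} 2 x) (combine-remQuot {n} 2 x)
  where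
  classify : ∀ iq → uncurry combine iq ≡ x → (∃[ i ] x ≡ oddPt {n} i) ⊎ (∃[ i ] x ≡ evenPt {n} i)
  classify (i , Fin.zero)         eq = inj₁ (i , sym eq)
  classify (i , Fin.suc Fin.zero) eq = inj₂ (i , sym eq)

transpose-matchˡ : ∀ {N} (i j : Fin N) → PC.transpose i j i ≡ j
transpose-matchˡ i j rewrite dec-true (i Fin.≟ i) refl = refl

transpose-matchʳ : ∀ {N} (i j : Fin N) → PC.transpose i j j ≡ i
transpose-matchʳ i j with j Fin.≟ i
... | yes j≡i = j≡i
... | no _ rewrite dec-true (j Fin.≟ j) refl = refl

transpose-mismatch : ∀ {N} {i j k : Fin N} → k ≢ i → k ≢ j → PC.transpose i j k ≡ k
transpose-mismatch {i = i} {j} {k} k≢i k≢j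
  rewrite dec-false (k Fin.≟ i) k≢i | dec-false (k Fin.≟ j) k≢j = refl

⟨$⟩ˡ-injective : ∀ {N} (σ : Permutation′ N) {x y} → σ ⟨$⟩ˡ x ≡ σ ⟨$⟩ˡ y → x ≡ y
⟨$⟩ˡ-injective σ eq = trans (sym (inverseʳ σ)) (trans (cong (σ ⟨$⟩ʳ_) eq) (inverseʳ σ))

⟨$⟩ʳ-⟨$⟩ˡ : ∀ {N} (σ : Permutation′ N) {x y} → σ ⟨$⟩ˡ y ≡ x → σ ⟨$⟩ʳ x ≡ y
⟨$⟩ʳ-⟨$⟩ˡ σ refl = inverseʳ σ

initially-separated : ∀ {n} {π : Permutation′ (n * 2)} → InDTilde n π →
                      ∀ y → Separated (toℕ y) (toℕ (π ⟨$⟩ˡ y))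
initially-separated {π = π} D y with oddPt-or-evenPt (π ⟨$⟩ˡ y)
... | inj₁ (i , y↤i) = subst (Separated (toℕ y) ∘ toℕ) (sym y↤i) (even-separated (toℕ-oddPt-%2 i)
      (subst (λ z → toℕ (oddPt i) ≤ toℕ z) (⟨$⟩ʳ-⟨$⟩ˡ π y↤i) (InDTilde.oddPos≥ D i)))
... | inj₂ (i , y↤i) = subst (Separated (toℕ y) ∘ toℕ) (sym y↤i) (odd-separated (toℕ-evenPt-%2 i)
      (subst (λ z → toℕ z < toℕ (evenPt i)) (⟨$⟩ʳ-⟨$⟩ˡ π y↤i) (InDTilde.evenPos< D i)))

bounded-induction : ∀ {m} (P : ℕ → Set) → P 0 → (∀ (k : Fin m) → P (toℕ k) → P (suc (toℕ k))) →
                    ∀ t → t ≤ m → P t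
bounded-induction P P0 Pstep zero    _   = P0
bounded-induction P P0 Pstep (suc t) t<m = subst (P ∘ suc) (toℕ-fromℕ< t<m)
  (Pstep (fromℕ< t<m) (subst P (sym (toℕ-fromℕ< t<m)) (bounded-induction P P0 Pstep t (<⇒≤ t<m))))

bounded-chain : ∀ {m} {A : Set} (_R_ : A → A → Set) → Reflexive _R_ → Transitive _R_ → (f : ℕ → A) →
                (∀ (k : Fin m) → f (toℕ k) R f (suc (toℕ k))) → ∀ {t t′} → t ≤ t′ → t′ ≤ m → f t R f t′
bounded-chain {m} _R_ R-refl R-trans f step {t} t≤t′ = go (≤⇒≤′ t≤t′)
  where
  go : ∀ {t′} → t ≤′ t′ → t′ ≤ m → f t R f t′
  go ≤′-refl          _   = R-refl
  go (≤′-step t≤′t′) t′<m = R-trans (go t≤′t′ (<⇒≤ t′<m))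
    (subst (λ s → f s R f (suc s)) (toℕ-fromℕ< t′<m) (step (fromℕ< t′<m)))

ΓStep-config : ∀ {n} (σ : Permutation′ (n * 2)) (E : Graph n) (u v : Fin n) →
               edgeConfig σ (evenPt u) (oddPt v) ≡ true →
               ΓStep (σ , E) (u , v) ≡ (σ ∘ₚ transpose (evenPt u) (oddPt v) , (u , v) ∷ E)
ΓStep-config σ E u v c rewrite c = refl

ΓStep-¬config : ∀ {n} (σ : Permutation′ (n * 2)) (E : Graph n) (u v : Fin n) →
                edgeConfig σ (evenPt u) (oddPt v) ≡ false → ΓStep (σ , E) (u , v) ≡ (σ , E)
ΓStep-¬config σ E u v c rewrite c = refl

module Run {n : ℕ} (π : Permutation′ (n * 2)) (D : InDTilde n π)
           (L : List (Fin n × Fin n)) (V : ValidOrder n L) where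

  open ValidOrder V

  N : ℕ
  N = n * 2

  m : ℕ
  m = length L

  state : ℕ → Permutation′ N × Graph n
  state t = foldl ΓStep (π , []) (take t L)

  perm : ℕ → Permutation′ N
  perm t = proj₁ (state t)

  edges : ℕ → Graph n
  edges t = proj₂ (state t)

  pos : ℕ → Fin N → ℕ
  pos t x = toℕ (perm t ⟨$⟩ˡ x)

  rankAt : ℕ → Fin N → ℕ
  rankAt t x = rank N (pos t x)

  configAt : ℕ → Fin n → Fin n → Bool
  configAt t u v = edgeConfig (perm t) (evenPt u) (oddPt v)

  pos<N : ∀ t x → pos t x < N
  pos<N t x = toℕ<n _

  pos-≢ : ∀ t {x y} → x ≢ y → pos t x ≢ pos t y
  pos-≢ t x≢y eq = x≢y (⟨$⟩ˡ-injective (perm t) (toℕ-injective eq))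

  Γ≡edges : Γ L π ≡ edges m
  Γ≡edges = cong (proj₂ ∘ foldl ΓStep (π , [])) (sym (take-all m L ≤-refl))

  same-step : ∀ {k k′ : Fin m} {e e′} → lookup L k ≡ e → lookup L k′ ≡ e′ → toℕ k ≡ toℕ k′ → e ≡ e′
  same-step s s′ k≡k′ = trans (sym s) (trans (cong (lookup L) (toℕ-injective k≡k′)) s′)

  step-of : ∀ {u v : Fin n} → u Fin.< v → ∃[ k ] lookup L k ≡ (u , v)
  step-of {u} {v} u<v = index mem , sym (lookup-index mem)
    where mem = complete u v u<v

  step-increasing : ∀ {k u v} → lookup L k ≡ (u , v) → u Fin.< v
  step-increasing {k} s = subst (λ e → proj₁ e Fin.< proj₂ e) s (All.lookup increasing (∈-lookup k))

  row-mono : ∀ {k k′ u v v′} → lookup L k ≡ (u , v) → lookup L k′ ≡ (u , v′) → v Fin.≤ v′ → toℕ k ≤ toℕ k′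
  row-mono s s′ v≤v′ = monotone _ _ (subst₂ _⪯_ (sym s) (sym s′) (≤-refl , v≤v′))

  column-mono : ∀ {k k′ u u′ v} → lookup L k ≡ (u , v) → lookup L k′ ≡ (u′ , v) → u′ Fin.≤ u → toℕ k ≤ toℕ k′
  column-mono s s′ u′≤u = monotone _ _ (subst₂ _⪯_ (sym s) (sym s′) (u′≤u , ≤-refl))

  row-mono-< : ∀ {k k′ u v v′} → lookup L k ≡ (u , v) → lookup L k′ ≡ (u , v′) → v Fin.< v′ → toℕ k < toℕ k′
  row-mono-< s s′ v<v′ =
    ≤∧≢⇒< (row-mono s s′ (<⇒≤ v<v′)) λ k≡k′ → <-irrefl (cong (toℕ ∘ proj₂) (same-step s s′ k≡k′)) v<v′

  column-mono-< : ∀ {k k′ u u′ v} → lookup L k ≡ (u , v) → lookup L k′ ≡ (u′ , v) → u′ Fin.< u → toℕ k < toℕ k′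
  column-mono-< s s′ u′<u =
    ≤∧≢⇒< (column-mono s s′ (<⇒≤ u′<u)) λ k≡k′ → <-irrefl (cong (toℕ ∘ proj₁) (same-step s′ s (sym k≡k′))) u′<u

  state-step : (k : Fin m) → state (suc (toℕ k)) ≡ ΓStep (state (toℕ k)) (lookup L k)
  state-step k = trans (cong (foldl ΓStep (π , [])) (take-suc L k))
                       (foldl-∷ʳ ΓStep (π , []) (lookup L k) (take (toℕ k) L))

  data Outcome (t : ℕ) (u v : Fin n) : Bool → Set where
    swap : pos (suc t) (evenPt u) ≡ pos t (oddPt v) → pos (suc t) (oddPt v) ≡ pos t (evenPt u) →
           (∀ x → x ≢ evenPt u → x ≢ oddPt v → pos (suc t) x ≡ pos t x) →
           edges (suc t) ≡ (u , v) ∷ edges t → Outcome t u v true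
    keep : (∀ x → pos (suc t) x ≡ pos t x) → edges (suc t) ≡ edges t → Outcome t u v false

  outcome : ∀ (k : Fin m) {u v} → lookup L k ≡ (u , v) → Outcome (toℕ k) u v (configAt (toℕ k) u v)
  outcome k {u} {v} s with configAt (toℕ k) u v in c
  ... | true  = swap (moved (evenPt u) (transpose-matchʳ (oddPt v) (evenPt u)))
                     (moved (oddPt v) (transpose-matchˡ (oddPt v) (evenPt u)))
                     (λ x x≢e x≢o → moved x (transpose-mismatch x≢o x≢e))
                     (cong proj₂ after)
    where
    after : state (suc (toℕ k)) ≡ (perm (toℕ k) ∘ₚ transpose (evenPt u) (oddPt v) , (u , v) ∷ edges (toℕ k))
    after = trans (state-step k) (trans (cong (ΓStep (state (toℕ k))) s) (ΓStep-config _ _ u v c))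
    moved : ∀ x {y} → PC.transpose (oddPt v) (evenPt u) x ≡ y → pos (suc (toℕ k)) x ≡ pos (toℕ k) y
    moved x x↦y = trans (cong (λ st → toℕ (proj₁ st ⟨$⟩ˡ x)) after) (cong (pos (toℕ k)) x↦y)
  ... | false = keep (λ x → cong (λ st → toℕ (proj₁ st ⟨$⟩ˡ x)) after) (cong proj₂ after)
    where
    after : state (suc (toℕ k)) ≡ state (toℕ k)
    after = trans (state-step k) (trans (cong (ΓStep (state (toℕ k))) s) (ΓStep-¬config _ _ u v c))

  pos-unchanged : ∀ (k : Fin m) {u v} → lookup L k ≡ (u , v) →
                  ∀ x → x ≢ evenPt u → x ≢ oddPt v → pos (suc (toℕ k)) x ≡ pos (toℕ k) x
  pos-unchanged k {u} {v} s x x≢e x≢o with configAt (toℕ k) u v | outcome k s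
  ... | true  | swap _ _ others _ = others x x≢e x≢o
  ... | false | keep same _       = same x

  evenPt-unchanged : ∀ (k : Fin m) {u₀ v₀ u} → lookup L k ≡ (u₀ , v₀) → u ≢ u₀ →
                     pos (suc (toℕ k)) (evenPt u) ≡ pos (toℕ k) (evenPt u)
  evenPt-unchanged k {v₀ = v₀} {u} s u≢u₀ =
    pos-unchanged k s (evenPt u) (u≢u₀ ∘ evenPt-injective) (evenPt≢oddPt u v₀)

  oddPt-unchanged : ∀ (k : Fin m) {u₀ v₀ v} → lookup L k ≡ (u₀ , v₀) → v ≢ v₀ →
                    pos (suc (toℕ k)) (oddPt v) ≡ pos (toℕ k) (oddPt v)
  oddPt-unchanged k {u₀} {v = v} s v≢v₀ =
    pos-unchanged k s (oddPt v) (evenPt≢oddPt u₀ v ∘ sym) (v≢v₀ ∘ oddPt-injective)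

  ProcessedBefore : ℕ → Fin n × Fin n → Set
  ProcessedBefore t e = ∃[ k ] lookup L k ≡ e × toℕ k < t

  record NextInRow (t : ℕ) (u v : Fin n) : Set where
    field
      u<v          : u Fin.< v
      pending      : ¬ ProcessedBefore t (u , v)
      earlier-done : ∀ w → u Fin.< w → w Fin.< v → ProcessedBefore t (u , w)

  open NextInRow

  next-in-row-at : ∀ {k u v} → lookup L k ≡ (u , v) → NextInRow (toℕ k) u v
  next-in-row-at s = record
    { u<v          = step-increasing s
    ; pending      = λ (_ , s′ , k′<k) → <⇒≱ k′<k (row-mono s s′ ≤-refl)
    ; earlier-done = λ w u<w w<v → let (k′ , s′) = step-of u<w in k′ , s′ , row-mono-< s′ s w<v
    }

  next-in-row-initial : ∀ {u v} → NextInRow 0 u v → toℕ v ≡ suc (toℕ u)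
  next-in-row-initial {u} {v} r = ≤-antisym (≮⇒≥ u+1≮v) (u<v r)
    where
    u+1≮v : ¬ suc (toℕ u) < toℕ v
    u+1≮v u+1<v with fin-between u+1<v
    ... | w , u<w , w<v with earlier-done r w u<w w<v
    ...   | _ , _ , ()

  next-in-row-other : ∀ {k u₀ v₀ u v} → lookup L k ≡ (u₀ , v₀) → u ≢ u₀ →
                      NextInRow (suc (toℕ k)) u v → NextInRow (toℕ k) u v
  next-in-row-other s u≢u₀ r = record
    { u<v          = u<v r
    ; pending      = λ (k′ , s′ , k′<k) → pending r (k′ , s′ , m<n⇒m<1+n k′<k)
    ; earlier-done = λ w u<w w<v → let (k′ , s′ , k′<1+k) = earlier-done r w u<w w<v in
        k′ , s′ , ≤∧≢⇒< (s≤s⁻¹ k′<1+k) (λ k′≡k → u≢u₀ (cong proj₁ (same-step s′ s k′≡k)))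
    }

  next-in-row-same : ∀ {k u v₀ v} → lookup L k ≡ (u , v₀) → NextInRow (suc (toℕ k)) u v → toℕ v ≡ suc (toℕ v₀)
  next-in-row-same {v₀ = v₀} {v} s r = ≤-antisym (≮⇒≥ v₀+1≮v) v₀<v
    where
    v₀<v : v₀ Fin.< v
    v₀<v = ≰⇒> λ v≤v₀ → let (k′ , s′) = step-of (u<v r) in pending r (k′ , s′ , s≤s (row-mono s′ s v≤v₀))
    v₀+1≮v : ¬ suc (toℕ v₀) < toℕ v
    v₀+1≮v v₀+1<v with fin-between v₀+1<v
    ... | w , v₀<w , w<v with earlier-done r w (<-trans (step-increasing s) v₀<w) w<v
    ...   | _ , s′ , k′<1+k = <⇒≱ k′<1+k (row-mono-< s s′ v₀<w)

  record Invariant (t : ℕ) : Set where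
    field
      oddPt-separated  : ∀ (v : Fin n) → Separated (2 * toℕ v) (pos t (oddPt v))
      evenPt-separated : ∀ {u v : Fin n} → NextInRow t u v → Separated (2 * toℕ v) (pos t (evenPt u))

  open Invariant

  invariant-initial : Invariant 0
  invariant-initial = record
    { oddPt-separated  = λ v → subst (λ y → Separated y (pos 0 (oddPt v))) (toℕ-oddPt v)
                                     (initially-separated D (oddPt v))
    ; evenPt-separated = λ {u} r →
        subst (λ y → Separated (2 * y) (pos 0 (evenPt u))) (sym (next-in-row-initial r))
              (separated-raise (subst (λ y → Separated y (pos 0 (evenPt u))) (toℕ-evenPt u)
                                      (initially-separated D (evenPt u))))
    }

  rankOrdered-at : ∀ {k u v} → Invariant (toℕ k) → lookup L k ≡ (u , v) →
                   RankOrdered N (pos (toℕ k) (evenPt u)) (pos (toℕ k) (oddPt v)) (configAt (toℕ k) u v)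
  rankOrdered-at {k} {u} {v} I s =
    rankOrdered (pos<N (toℕ k) (evenPt u)) (pos<N (toℕ k) (oddPt v)) (pos-≢ (toℕ k) (evenPt≢oddPt u v))
                (evenPt-separated I (next-in-row-at s)) (oddPt-separated I v)

  compared-separated : ∀ {k u v} → Invariant (toℕ k) → lookup L k ≡ (u , v) →
                       Separated (2 * toℕ v) (pos (suc (toℕ k)) (oddPt v)) ×
                       Separated (2 * suc (toℕ v)) (pos (suc (toℕ k)) (evenPt u))
  compared-separated {k} {u} {v} I s
    with configAt (toℕ k) u v | outcome k s | rankOrdered-at I s
       | evenPt-separated I (next-in-row-at s) | oddPt-separated I v
  ... | true  | swap e↦ o↦ _ _ | p<q | Sp | Sq =
    subst (Separated _) (sym o↦) Sp ,
    subst (Separated _) (sym e↦) (separated-winner (pos<N (toℕ k) (oddPt v)) Sp Sq p<q)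
  ... | false | keep same _     | q<p | Sp | Sq =
    subst (Separated _) (sym (same _)) Sq ,
    subst (Separated _) (sym (same _)) (separated-winner (pos<N (toℕ k) (evenPt u)) Sq Sp q<p)

  invariant-step : (k : Fin m) → Invariant (toℕ k) → Invariant (suc (toℕ k))
  invariant-step k I with lookup L k in s
  ... | u₀ , v₀ = record { oddPt-separated = odd ; evenPt-separated = even }
    where
    odd : ∀ v → Separated (2 * toℕ v) (pos (suc (toℕ k)) (oddPt v))
    odd v with v Fin.≟ v₀
    ... | yes refl = proj₁ (compared-separated I s)
    ... | no v≢v₀  = subst (Separated _) (sym (oddPt-unchanged k s v≢v₀)) (oddPt-separated I v)
    even : ∀ {u v} → NextInRow (suc (toℕ k)) u v → Separated (2 * toℕ v) (pos (suc (toℕ k)) (evenPt u))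
    even {u} {v} r with u Fin.≟ u₀
    ... | yes refl = subst (λ y → Separated (2 * y) _) (sym (next-in-row-same s r)) (proj₂ (compared-separated I s))
    ... | no u≢u₀  = subst (Separated _) (sym (evenPt-unchanged k s u≢u₀))
                           (evenPt-separated I (next-in-row-other s u≢u₀ r))

  invariant : (k : Fin m) → Invariant (toℕ k)
  invariant k = bounded-induction Invariant invariant-initial invariant-step (toℕ k) (<⇒≤ (toℕ<n k))

  compare-exchange : ∀ {k u v} → lookup L k ≡ (u , v) →
                     rankAt (toℕ k) (evenPt u) ≤ rankAt (suc (toℕ k)) (evenPt u) ×
                     rankAt (suc (toℕ k)) (oddPt v) ≤ rankAt (toℕ k) (oddPt v) ×
                     rankAt (suc (toℕ k)) (oddPt v) < rankAt (suc (toℕ k)) (evenPt u)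
  compare-exchange {k} {u} {v} s with configAt (toℕ k) u v | outcome k s | rankOrdered-at (invariant k) s
  ... | true  | swap e↦ o↦ _ _ | p<q rewrite e↦ | o↦ = <⇒≤ p<q , <⇒≤ p<q , p<q
  ... | false | keep same _     | q<p rewrite same (evenPt u) | same (oddPt v) = ≤-refl , ≤-refl , q<p

  evenPt-rank-mono : ∀ u {t t′} → t ≤ t′ → t′ ≤ m → rankAt t (evenPt u) ≤ rankAt t′ (evenPt u)
  evenPt-rank-mono u = bounded-chain _≤_ ≤-refl ≤-trans (λ t → rankAt t (evenPt u)) step
    where
    step : (k : Fin m) → rankAt (toℕ k) (evenPt u) ≤ rankAt (suc (toℕ k)) (evenPt u)
    step k with lookup L k in s
    ... | u₀ , _ with u Fin.≟ u₀
    ...   | yes refl = proj₁ (compare-exchange s)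
    ...   | no u≢u₀  = ≤-reflexive (cong (rank N) (sym (evenPt-unchanged k s u≢u₀)))

  oddPt-rank-antitone : ∀ v {t t′} → t ≤ t′ → t′ ≤ m → rankAt t′ (oddPt v) ≤ rankAt t (oddPt v)
  oddPt-rank-antitone v = bounded-chain _≥_ ≤-refl (flip ≤-trans) (λ t → rankAt t (oddPt v)) step
    where
    step : (k : Fin m) → rankAt (suc (toℕ k)) (oddPt v) ≤ rankAt (toℕ k) (oddPt v)
    step k with lookup L k in s
    ... | _ , v₀ with v Fin.≟ v₀
    ...   | yes refl = proj₁ (proj₂ (compare-exchange s))
    ...   | no v≢v₀  = ≤-reflexive (cong (rank N) (oddPt-unchanged k s v≢v₀))

  Inserts : Fin m → Fin n → Fin n → Set
  Inserts k u v = lookup L k ≡ (u , v) × configAt (toℕ k) u v ≡ true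

  inserts-outcome : ∀ {k u v} → Inserts k u v → Outcome (toℕ k) u v true
  inserts-outcome {k} (s , c) = subst (Outcome (toℕ k) _ _) c (outcome k s)

  edges-step : (k : Fin m) → edges (toℕ k) ⊆ edges (suc (toℕ k))
  edges-step k with lookup L k in s
  ... | u , v with configAt (toℕ k) u v | outcome k s
  ...   | true  | swap _ _ _ grown = subst (edges (toℕ k) ⊆_) (sym grown) (xs⊆x∷xs _ _)
  ...   | false | keep _ same      = subst (edges (toℕ k) ⊆_) (sym same) ⊆-refl

  inserted-edge : ∀ {k u v} → Inserts k u v → (u , v) ∈ edges m
  inserted-edge {k} ins with inserts-outcome ins
  ... | swap _ _ _ grown = bounded-chain _⊆_ ⊆-refl ⊆-trans edges edges-step (toℕ<n k) ≤-refl
                             (subst (_ ∈_) (sym grown) (here refl))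

  EdgesInserted : ℕ → Set
  EdgesInserted t = ∀ {u v} → (u , v) ∈ edges t → ∃[ k ] Inserts k u v

  edge-inserted : EdgesInserted m
  edge-inserted = bounded-induction EdgesInserted (λ ()) step m ≤-refl
    where
    step : (k : Fin m) → EdgesInserted (toℕ k) → EdgesInserted (suc (toℕ k))
    step k IH e∈ with lookup L k in s
    ... | u₀ , v₀ with configAt (toℕ k) u₀ v₀ in c | outcome k s
    ...   | false | keep _ same = IH (subst (_ ∈_) same e∈)
    ...   | true  | swap _ _ _ grown with subst (_ ∈_) grown e∈
    ...     | here refl  = k , s , c
    ...     | there e∈′ = IH e∈′

  RowBound : Fin n → Fin n → ℕ → Set
  RowBound a c t = ∃[ j ] ∃[ k ] lookup L k ≡ (a , j) × toℕ k < t × c Fin.≤ j ×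
                   rankAt t (evenPt a) ≤ rankAt (toℕ k) (oddPt j)

  row-bound-start : ∀ {k a c} → Inserts k a c → RowBound a c (suc (toℕ k))
  row-bound-start {k} {c = c} ins with inserts-outcome ins
  ... | swap e↦ _ _ _ = c , k , proj₁ ins , n<1+n _ , ≤-refl , ≤-reflexive (cong (rank N) e↦)

  row-bound-step : ∀ {kc a c} → Inserts kc a c → (k : Fin m) → toℕ kc < toℕ k →
                   RowBound a c (toℕ k) → RowBound a c (suc (toℕ k))
  row-bound-step {a = a} {c} ins k kc<k (j , kj , sj , kj<k , c≤j , bound) with lookup L k in s
  ... | u₀ , v₀ with a Fin.≟ u₀
  ...   | no a≢u₀ = j , kj , sj , m<n⇒m<1+n kj<k , c≤j ,
                    subst (_≤ _) (cong (rank N) (sym (evenPt-unchanged k s a≢u₀))) bound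
  ...   | yes refl with configAt (toℕ k) a v₀ | outcome k s
  ...     | false | keep same _ = j , kj , sj , m<n⇒m<1+n kj<k , c≤j ,
                                  subst (_≤ _) (cong (rank N) (sym (same _))) bound
  ...     | true  | swap e↦ _ _ _ = v₀ , k , s , n<1+n _ , c≤v₀ , ≤-reflexive (cong (rank N) e↦)
    where
    c≤v₀ : c Fin.≤ v₀
    c≤v₀ = ≮⇒≥ λ v₀<c → <⇒≱ kc<k (row-mono s (proj₁ ins) (<⇒≤ v₀<c))

  row-bound : ∀ {kc a c} → Inserts kc a c → ∀ t → t ≤ m → toℕ kc < t → RowBound a c t
  row-bound {kc} {a} {c} ins = bounded-induction (λ t → toℕ kc < t → RowBound a c t) (λ ()) step
    where
    step : (k : Fin m) → (toℕ kc < toℕ k → RowBound a c (toℕ k)) →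
           toℕ kc < suc (toℕ k) → RowBound a c (suc (toℕ k))
    step k IH kc<1+k with m≤n⇒m<n∨m≡n (s≤s⁻¹ kc<1+k)
    ... | inj₁ kc<k = row-bound-step ins k kc<k (IH kc<k)
    ... | inj₂ kc≡k = subst (RowBound a c ∘ suc) kc≡k (row-bound-start ins)

  ColumnBound : Fin n → Fin n → ℕ → Set
  ColumnBound b d t = ∃[ i ] ∃[ k ] lookup L k ≡ (i , d) × toℕ k < t × i Fin.≤ b ×
                      rankAt (toℕ k) (evenPt i) ≤ rankAt t (oddPt d)

  column-bound-start : ∀ {k b d} → Inserts k b d → ColumnBound b d (suc (toℕ k))
  column-bound-start {k} {b} ins with inserts-outcome ins
  ... | swap _ o↦ _ _ = b , k , proj₁ ins , n<1+n _ , ≤-refl , ≤-reflexive (cong (rank N) (sym o↦))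

  column-bound-step : ∀ {kd b d} → Inserts kd b d → (k : Fin m) → toℕ kd < toℕ k →
                      ColumnBound b d (toℕ k) → ColumnBound b d (suc (toℕ k))
  column-bound-step {b = b} {d} ins k kd<k (i , ki , si , ki<k , i≤b , bound) with lookup L k in s
  ... | u₀ , v₀ with d Fin.≟ v₀
  ...   | no d≢v₀ = i , ki , si , m<n⇒m<1+n ki<k , i≤b ,
                    subst (_ ≤_) (cong (rank N) (sym (oddPt-unchanged k s d≢v₀))) bound
  ...   | yes refl with configAt (toℕ k) u₀ d | outcome k s
  ...     | false | keep same _ = i , ki , si , m<n⇒m<1+n ki<k , i≤b ,
                                  subst (_ ≤_) (cong (rank N) (sym (same _))) bound
  ...     | true  | swap _ o↦ _ _ = u₀ , k , s , n<1+n _ , u₀≤b , ≤-reflexive (cong (rank N) (sym o↦))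
    where
    u₀≤b : u₀ Fin.≤ b
    u₀≤b = ≮⇒≥ λ b<u₀ → <⇒≱ kd<k (column-mono s (proj₁ ins) (<⇒≤ b<u₀))

  column-bound : ∀ {kd b d} → Inserts kd b d → ∀ t → t ≤ m → toℕ kd < t → ColumnBound b d t
  column-bound {kd} {b} {d} ins = bounded-induction (λ t → toℕ kd < t → ColumnBound b d t) (λ ()) step
    where
    step : (k : Fin m) → (toℕ kd < toℕ k → ColumnBound b d (toℕ k)) →
           toℕ kd < suc (toℕ k) → ColumnBound b d (suc (toℕ k))
    step k IH kd<1+k with m≤n⇒m<n∨m≡n (s≤s⁻¹ kd<1+k)
    ... | inj₁ kd<k = column-bound-step ins k kd<k (IH kd<k)
    ... | inj₂ kd≡k = subst (ColumnBound b d ∘ suc) kd≡k (column-bound-start ins)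

  crossing-rank< : ∀ {kac kbd kad a b c d} → a Fin.< b → b Fin.< c → c Fin.< d →
                   Inserts kac a c → Inserts kbd b d → lookup L kad ≡ (a , d) →
                   rankAt (toℕ kad) (evenPt a) < rankAt (toℕ kad) (oddPt d)
  crossing-rank< {kad = kad} {a} {d = d} a<b b<c c<d ins-ac ins-bd sad
    with row-bound ins-ac (toℕ kad) (<⇒≤ (toℕ<n kad)) (row-mono-< (proj₁ ins-ac) sad c<d)
       | column-bound ins-bd (toℕ kad) (<⇒≤ (toℕ<n kad)) (column-mono-< (proj₁ ins-bd) sad a<b)
  ... | j , kj , saj , kj<kad , c≤j , a-bound | i , ki , sid , ki<kad , i≤b , d-bound = begin-strict
    rankAt (toℕ kad) (evenPt a)        ≤⟨ a-bound ⟩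
    rankAt (toℕ kj) (oddPt j)          ≤⟨ oddPt-rank-antitone j (column-mono-< sij saj a<i) (<⇒≤ (toℕ<n kj)) ⟩
    rankAt (suc (toℕ kij)) (oddPt j)   <⟨ proj₂ (proj₂ (compare-exchange sij)) ⟩
    rankAt (suc (toℕ kij)) (evenPt i)  ≤⟨ evenPt-rank-mono i (row-mono-< sij sid j<d) (<⇒≤ (toℕ<n ki)) ⟩
    rankAt (toℕ ki) (evenPt i)         ≤⟨ d-bound ⟩
    rankAt (toℕ kad) (oddPt d)         ∎
    where
    open ≤-Reasoning
    j<d : j Fin.< d
    j<d = ≰⇒> λ d≤j → <⇒≱ kj<kad (row-mono sad saj d≤j)
    a<i : a Fin.< i
    a<i = ≰⇒> λ i≤a → <⇒≱ ki<kad (column-mono sad sid i≤a)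
    i<j : i Fin.< j
    i<j = ≤-<-trans i≤b (<-≤-trans b<c c≤j)
    kij = proj₁ (step-of i<j)
    sij = proj₂ (step-of i<j)

  crossing-inserts : ∀ {kac kbd kad a b c d} → a Fin.< b → b Fin.< c → c Fin.< d →
                     Inserts kac a c → Inserts kbd b d → lookup L kad ≡ (a , d) → Inserts kad a d
  crossing-inserts {kad = kad} {a} {d = d} a<b b<c c<d ins-ac ins-bd sad = sad , config
    where
    config : configAt (toℕ kad) a d ≡ true
    config with configAt (toℕ kad) a d | rankOrdered-at (invariant kad) sad
    ... | true  | _   = refl
    ... | false | d<a = contradiction (crossing-rank< a<b b<c c<d ins-ac ins-bd sad) (<⇒≯ d<a)

mainTheorem6 : (n : ℕ) (π : Permutation′ (n * 2)) → InDTilde n π →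
    (L : List (Fin n × Fin n)) → ValidOrder n L → TerrainLike (Γ L π)
mainTheorem6 n π D L V a b c d a<b b<c c<d ac∈Γ bd∈Γ =
  subst ((a , d) ∈_) (sym Γ≡edges) (inserted-edge (crossing-inserts a<b b<c c<d ins-ac ins-bd sad))
  where
  open Run π D L V
  ins-ac = proj₂ (edge-inserted (subst ((a , c) ∈_) Γ≡edges ac∈Γ))
  ins-bd = proj₂ (edge-inserted (subst ((b , d) ∈_) Γ≡edges bd∈Γ))
  sad    = proj₂ (step-of (<-trans a<b (<-trans b<c c<d)))
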